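{- Let $f:(A,P_A)\to(B,P_B)$ be a surjective strictly order-preserving map that is surjective on the cover relation of $P_B$, i.e. for every $(b,b')\in\mathrm{TrRd}(P_B)$ there is $(a,a')\in P_A$ with $f(a)=b$, $f(a')=b'$. Then $f$ is a regular epimorphism in $\mathsf{PoSet}$.
   Context: $\mathsf{PoSet}$ is the category of finite sets with a strict partial order (asymmetric, transitive relation) and strictly order-preserving maps. A regular epimorphism is a morphism that is the coequalizer of some parallel pair of morphisms. $\mathrm{TrRd}(P_B)$ is the transitive reduction (cover relation) of $P_B$: the pairs $(b,b')\in P_B$ with no $c$ such that $(b,c),(c,b')\in P_B$. -}

module Defs where

open import Data.Nat using (ℕ)
open import Data.Fin using (Fin)
open import Data.Bool using (Bool; T)
open import Data.Product using (Σ; ∃; _×_; _,_)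
open import Relation.Nullary using (¬_)
open import Relation.Binary.PropositionalEquality using (_≡_)

-- An object of PoSet: a finite set (represented, up to isomorphism, as Fin size)
-- with a strict partial order (asymmetric, transitive relation).
-- The relation is Bool-valued: every relation on a finite set is decidable.
record FinPoset : Set where
  field
    size  : ℕ
    rel   : Fin size → Fin size → Bool
    asym  : ∀ x y → T (rel x y) → ¬ T (rel y x)
    trans : ∀ x y z → T (rel x y) → T (rel y z) → T (rel x z)

open FinPoset public

record Hom (X Y : FinPoset) : Set where
  field
    fun  : Fin (size X) → Fin (size Y)
    mono : ∀ x y → T (rel X x y) → T (rel Y (fun x) (fun y))

open Hom public

_≈_ : {X Y : FinPoset} → Hom X Y → Hom X Y → Set
_≈_ {X} f g = ∀ (x : Fin (size X)) → fun f x ≡ fun g x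

_∘_ : {X Y Z : FinPoset} → Hom Y Z → Hom X Y → Hom X Z
fun  (g ∘ f) x = fun g (fun f x)
mono (g ∘ f) x y p = mono g (fun f x) (fun f y) (mono f x y p)

IsCoequalizer : {C X Q : FinPoset} → Hom C X → Hom C X → Hom X Q → Set
IsCoequalizer {C} {X} {Q} g h e =
  ((e ∘ g) ≈ (e ∘ h)) ×
  (∀ (Z : FinPoset) (k : Hom X Z) → (k ∘ g) ≈ (k ∘ h) →
     Σ (Hom Q Z) λ u → ((u ∘ e) ≈ k) × (∀ (u' : Hom Q Z) → (u' ∘ e) ≈ k → u' ≈ u))

IsRegularEpi : {X Q : FinPoset} → Hom X Q → Set
IsRegularEpi {X} e = Σ FinPoset λ C → Σ (Hom C X) λ g → Σ (Hom C X) λ h → IsCoequalizer g h e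

Cover : (B : FinPoset) → Fin (size B) → Fin (size B) → Set
Cover B b b' = T (rel B b b') × (∀ c → ¬ (T (rel B b c) × T (rel B c b')))

Surjective : {A B : FinPoset} → Hom A B → Set
Surjective {A} {B} f = ∀ (b : Fin (size B)) → ∃ λ (a : Fin (size A)) → fun f a ≡ b

SurjectiveOnCovers : {A B : FinPoset} → Hom A B → Set
SurjectiveOnCovers {A} {B} f =
  ∀ (b b' : Fin (size B)) → Cover B b b' →
    Σ (Fin (size A)) λ a → Σ (Fin (size A)) λ a' →
      T (rel A a a') × (fun f a ≡ b) × (fun f a' ≡ b')

{-# OPTIONS --safe #-}
module Submission where

-- A map k constant on the fibres of f descends along the surjection f to a map k̄ on B.
-- k̄ sends covers to relations, because f hits every cover and k is monotone; and on a
-- finite poset every relation is a chain of covers, so k̄ is monotone. Hence f is the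
-- coequalizer of its kernel pair.

open import Defs
open import Level using (0ℓ)
open import Data.Nat using (ℕ; _*_)
open import Data.Fin using (Fin; combine; remQuot)
open import Data.Fin.Properties using (any?; remQuot-combine) renaming (_≟_ to _≟ᶠ_)
open import Data.Fin.Induction using (spo-wellFounded; spo-noetherian)
open import Data.Bool using (false; T)
open import Data.Product using (Σ; _×_; _,_; proj₁; proj₂)
open import Function using (flip)
open import Induction.WellFounded using (Acc; acc)
open import Relation.Nullary using (yes; no; contradiction)
open import Relation.Nullary.Decidable using (T?; _×-dec_)
open import Relation.Binary using (Rel; Transitive; IsStrictPartialOrder)
open import Relation.Binary.PropositionalEquality
  using (_≡_; refl; sym; cong; subst; subst₂; isEquivalence; resp₂; module ≡-Reasoning)

order : (P : FinPoset) → Rel (Fin (size P)) 0ℓ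
order P x y = T (rel P x y)

order-isStrictPartialOrder : (P : FinPoset) → IsStrictPartialOrder _≡_ (order P)
order-isStrictPartialOrder P = record
  { isEquivalence = isEquivalence
  ; irrefl        = λ { refl x<x → asym P _ _ x<x x<x }
  ; trans         = λ {x} {y} {z} → FinPoset.trans P x y z
  ; <-resp-≈      = resp₂ (order P)
  }

module _ (B : FinPoset) {c ℓ} {Y : Set c} {_⊏_ : Rel Y ℓ} (⊏-trans : Transitive _⊏_)
         (φ : Fin (size B) → Y) (φ-covers : ∀ b b' → Cover B b b' → φ b ⊏ φ b') where

  private
    _<_ = order B

  -- Induction on b' downwards, and for fixed b' on b upwards: splitting b < b' at some
  -- b < c < b' lowers the upper end in the first half and raises the lower end in the second.
  cover-preserving⇒monotone : ∀ {b b'} → b < b' → φ b ⊏ φ b'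
  cover-preserving⇒monotone {b} {b'} =
    go (spo-wellFounded (order-isStrictPartialOrder B) b')
       (spo-noetherian (order-isStrictPartialOrder B) b)
    where
      go : ∀ {b b'} → Acc _<_ b' → Acc (flip _<_) b → b < b' → φ b ⊏ φ b'
      go {b} {b'} (acc below) acc-b@(acc above) b<b'
        with any? (λ c → T? (rel B b c) ×-dec T? (rel B c b'))
      ... | yes (c , b<c , c<b') =
        ⊏-trans (go (below c<b') acc-b b<c) (go (acc below) (above b<c) c<b')
      ... | no ∄c = φ-covers b b' (b<b' , λ c b<c<b' → ∄c (c , b<c<b'))

discrete : ℕ → FinPoset
discrete n = record { size = n ; rel = λ _ _ → false ; asym = λ _ _ () ; trans = λ _ _ _ () }

fromDiscrete : ∀ {n} {P : FinPoset} → (Fin n → Fin (size P)) → Hom (discrete n) P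
fromDiscrete φ = record { fun = φ ; mono = λ _ _ () }

ConstantOnFibres : {A B Z : FinPoset} → Hom A B → Hom A Z → Set
ConstantOnFibres {A} f k = ∀ a a' → fun f a ≡ fun f a' → fun k a ≡ fun k a'

Factorisation : {A B Z : FinPoset} → Hom A B → Hom A Z → Set
Factorisation {B = B} {Z} f k = Σ (Hom B Z) λ u → ((u ∘ f) ≈ k) × (∀ u' → (u' ∘ f) ≈ k → u' ≈ u)

module _ {A B : FinPoset} (f : Hom A B) (surj : Surjective f) where

  private
    section : Fin (size B) → Fin (size A)
    section b = proj₁ (surj b)

    section-inverse : ∀ b → fun f (section b) ≡ b
    section-inverse b = proj₂ (surj b)

  factorisation-unique : {Z : FinPoset} {k : Hom A Z} (u : Hom B Z) → (u ∘ f) ≈ k →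
                         ∀ b → fun u b ≡ fun k (section b)
  factorisation-unique {k = k} u u∘f≈k b = begin
    fun u b                    ≡⟨ cong (fun u) (sym (section-inverse b)) ⟩
    fun u (fun f (section b))  ≡⟨ u∘f≈k (section b) ⟩
    fun k (section b)          ∎
    where open ≡-Reasoning

  module _ (cov : SurjectiveOnCovers f) {Z : FinPoset} (k : Hom A Z) (k-fibres : ConstantOnFibres f k) where

    descend-covers : ∀ b b' → Cover B b b' → T (rel Z (fun k (section b)) (fun k (section b')))
    descend-covers b b' b⋖b' with cov b b' b⋖b'
    ... | a , a' , a<a' , refl , refl =
      subst₂ (order Z) (k-fibres a _ (sym (section-inverse b)))
                       (k-fibres a' _ (sym (section-inverse b')))
                       (mono k a a' a<a')

    descend : Hom B Z
    descend = record
      { fun  = λ b → fun k (section b)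
      ; mono = λ _ _ → cover-preserving⇒monotone B (λ {x y z} → FinPoset.trans Z x y z)
                         (λ b → fun k (section b)) descend-covers
      }

    descend∘f≈k : (descend ∘ f) ≈ k
    descend∘f≈k a = k-fibres _ a (section-inverse (fun f a))

    descend-factorisation : Factorisation f k
    descend-factorisation = descend , descend∘f≈k , factorisation-unique {k = k}

module KernelPair {A B : FinPoset} (f : Hom A B) where

  Pairs : FinPoset
  Pairs = discrete (size A * size A)

  -- Pairs outside the kernel of f are sent to the diagonal, so that all of
  -- Fin (size A * size A) can index the kernel pair.
  second : Fin (size A) × Fin (size A) → Fin (size A)
  second (a , a') with fun f a ≟ᶠ fun f a'
  ... | yes _ = a'
  ... | no _  = a

  π₁ π₂ : Hom Pairs A
  π₁ = fromDiscrete λ p → proj₁ (remQuot (size A) p)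
  π₂ = fromDiscrete λ p → second (remQuot (size A) p)

  second-sameImage : ∀ q → fun f (proj₁ q) ≡ fun f (second q)
  second-sameImage (a , a') with fun f a ≟ᶠ fun f a'
  ... | yes fa≡fa' = fa≡fa'
  ... | no _       = refl

  second-kernel : ∀ {a a'} → fun f a ≡ fun f a' → second (a , a') ≡ a'
  second-kernel {a} {a'} fa≡fa' with fun f a ≟ᶠ fun f a'
  ... | yes _       = refl
  ... | no fa≢fa'   = contradiction fa≡fa' fa≢fa'

  f∘π₁≈f∘π₂ : (f ∘ π₁) ≈ (f ∘ π₂)
  f∘π₁≈f∘π₂ p = second-sameImage (remQuot (size A) p)

  coequalizing⇒constantOnFibres : ∀ {Z} (k : Hom A Z) → (k ∘ π₁) ≈ (k ∘ π₂) → ConstantOnFibres f k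
  coequalizing⇒constantOnFibres k k∘π₁≈k∘π₂ a a' fa≡fa' = begin
    fun k a                    ≡⟨ subst (λ q → fun k (proj₁ q) ≡ fun k (second q))
                                        (remQuot-combine a a') (k∘π₁≈k∘π₂ (combine a a')) ⟩
    fun k (second (a , a'))    ≡⟨ cong (fun k) (second-kernel fa≡fa') ⟩
    fun k a'                   ∎
    where open ≡-Reasoning

  kernelPair-coequalizer : Surjective f → SurjectiveOnCovers f → IsCoequalizer π₁ π₂ f
  kernelPair-coequalizer surj cov =
    f∘π₁≈f∘π₂ , λ Z k k∘π₁≈k∘π₂ →
      descend-factorisation f surj cov k (coequalizing⇒constantOnFibres k k∘π₁≈k∘π₂)

open KernelPair

lemmaA23 : {A B : FinPoset} (f : Hom A B) → Surjective f → SurjectiveOnCovers f → IsRegularEpi f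
lemmaA23 f surj cov = Pairs f , π₁ f , π₂ f , kernelPair-coequalizer f surj cov
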